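{- Let $f(n)=an^{2}+bn+c$ with $a,b,c\in\mathbb{Z}$, $a$ odd and $b$ even, and suppose $b^{2}-4ac=4^{\ell}\Delta$ where $\ell$ is the largest positive integer with $4^{\ell}\mid b^2-4ac$ and $\Delta\equiv 1\pmod 8$. Then the 2-adic valuation tree of $f$ has two infinite branches.
   Context: $\nu_2(x)$ denotes the 2-adic valuation of an integer $x$ (with $\nu_2(0)=+\infty$), $\mathbb{N}=\{0,1,2,\ldots\}$. The 2-adic valuation tree of $f$: a node at level $i\geq 0$ is a residue class $\{2^{i}q+r: q\in\mathbb{N}\}$ with $0\le r<2^i$; the root (level 0) is all of $\mathbb{N}$. A node is terminating if $\nu_2(f(n))$ is constant on its class, and non-terminating otherwise. Each non-terminating node $\{2^iq+r\}$ has two children at level $i+1$, namely $\{2^{i+1}q+r\}$ and $\{2^{i+1}q+2^i+r\}$; terminating nodes have no children. An infinite branch is an infinite sequence of nodes, one at each level $i\geq 0$, each a child of the previous one. -}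

module Defs where

open import Data.Nat using (ℕ; suc; _<_; _^_) renaming (_+_ to _+ℕ_)
open import Data.Integer using (ℤ; +_; _+_; _*_; _-_)
open import Data.Integer.Divisibility using (_∣_)
open import Data.Maybe using (Maybe; just; nothing)
open import Data.Product using (∃; Σ; _×_; _,_)
open import Data.Sum using (_⊎_)
open import Relation.Binary.PropositionalEquality using (_≡_)
open import Relation.Nullary using (¬_)

quad : ℤ → ℤ → ℤ → ℕ → ℤ
quad a b c n = a * (+ n * + n) + b * (+ n) + c

-- ν₂ as a relation: Val₂ x v  means  ν₂(x) = v, where v = nothing encodes +∞.
Val₂ : ℤ → Maybe ℕ → Set
Val₂ x nothing  = x ≡ + 0
Val₂ x (just k) = (+ (2 ^ k) ∣ x) × ¬ (+ (2 ^ suc k) ∣ x)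

Terminating : (ℕ → ℤ) → (i r : ℕ) → Set
Terminating f i r = ∃ λ (v : Maybe ℕ) → ∀ (q : ℕ) → Val₂ (f (2 ^ i Data.Nat.* q +ℕ r)) v

NonTerminating : (ℕ → ℤ) → (i r : ℕ) → Set
NonTerminating f i r = ¬ Terminating f i r

-- An infinite branch of the 2-adic valuation tree of f: the node at level i is
-- the class of residue node i (mod 2^i); each node is a child of the previous one,
-- and every node has a child (so every node on it is non-terminating).
record InfiniteBranch (f : ℕ → ℤ) : Set where
  field
    node        : ℕ → ℕ
    node-lt     : ∀ i → node i < 2 ^ i
    node-child  : ∀ i → (node (suc i) ≡ node i) ⊎ (node (suc i) ≡ 2 ^ i +ℕ node i)
    node-nonterm : ∀ i → NonTerminating f i (node i)
open InfiniteBranch public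

SameBranch : ∀ {f} → InfiniteBranch f → InfiniteBranch f → Set
SameBranch B C = ∀ i → node B i ≡ node C i

HasExactlyTwoInfiniteBranches : (ℕ → ℤ) → Set
HasExactlyTwoInfiniteBranches f =
  Σ (InfiniteBranch f) λ B₁ → Σ (InfiniteBranch f) λ B₂ →
    ¬ SameBranch B₁ B₂ × (∀ (C : InfiniteBranch f) → SameBranch C B₁ ⊎ SameBranch C B₂)

module Submission where

-- Write b = 2b′, ℓ = m + 1 and Δ = 1 + 8k. Completing the square gives
-- a·f(X) = (aX + b′)² − 4^m·Δ, and Δ ≡ 1 (mod 8) makes Δ a 2-adic square, so f
-- has two 2-adic roots, differing by a unit times 2^ℓ. Each root determines a
-- branch: up to level ℓ + 1 its node is the residue class on which 2^j divides
-- the linear approximation L±(X) = aX + b′ ∓ 2^m of the corresponding factor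
-- (a linear form with odd slope has exactly one such child at each level), and
-- from then on the class on which 2^(j+ℓ) divides f. Near a root,
-- f(x + 2^j) − f(x) has valuation exactly j + ℓ, so exactly one child keeps the
-- higher divisibility and the other shows that the node is not terminating.
-- Conversely, on any infinite branch 2^(2ℓ+1) divides f, hence the product
-- L₊·(L₊ + 2^ℓ) = a·f + 8k·4^m; the two factors differ by 2^ℓ, so one of them is
-- divisible by 2^(ℓ+1), which pins the branch down to one of the two.

open import Data.Nat using (ℕ; suc)
open import Data.Integer using (ℤ)
open import Defs

module ResidueClasses where
  open import Data.Nat
  open import Data.Nat.Properties
  open import Data.Nat.DivMod using (_%_; [m+kn]%n≡m%n; m<n⇒m%n≡m)
  open import Data.Empty using (⊥; ⊥-elim)
  open import Data.Product using (Σ; ∃; _×_; _,_; proj₁; proj₂)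
  open import Data.Sum using (_⊎_; inj₁; inj₂; [_,_]′)
  open import Relation.Binary.PropositionalEquality
  open ≡-Reasoning

  record InClass (i r x : ℕ) : Set where
    constructor _,_
    field
      quotient : ℕ
      equation : x ≡ 2 ^ i * quotient + r

  IsChild : ℕ → ℕ → ℕ → Set
  IsChild i r y = y ≡ r ⊎ y ≡ 2 ^ i + r

  InClass-refl : ∀ i r → InClass i r r
  InClass-refl i r = 0 , cong (_+ r) (sym (*-zeroʳ (2 ^ i)))

  InClass-+2^ : ∀ {i r x} k → InClass i r x → InClass i r (2 ^ (k + i) + x)
  InClass-+2^ {i} {r} k (q , refl) = 2 ^ k + q , (begin
    2 ^ (k + i) + (2 ^ i * q + r)    ≡⟨ cong (_+ (2 ^ i * q + r)) (trans (^-distribˡ-+-* 2 k i) (*-comm (2 ^ k) (2 ^ i))) ⟩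
    2 ^ i * 2 ^ k + (2 ^ i * q + r)  ≡⟨ +-assoc (2 ^ i * 2 ^ k) _ r ⟨
    2 ^ i * 2 ^ k + 2 ^ i * q + r    ≡⟨ cong (_+ r) (*-distribˡ-+ (2 ^ i) (2 ^ k) q) ⟨
    2 ^ i * (2 ^ k + q) + r          ∎)

  even-or-odd : ∀ q → (∃ λ s → q ≡ 2 * s) ⊎ (∃ λ s → q ≡ suc (2 * s))
  even-or-odd zero = inj₁ (0 , refl)
  even-or-odd (suc q) with even-or-odd q
  ... | inj₁ (s , refl) = inj₂ (s , refl)
  ... | inj₂ (s , refl) = inj₁ (suc s , cong suc (sym (+-suc s (s + 0))))

  2^*2*≡2^suc* : ∀ i s → 2 ^ i * (2 * s) ≡ 2 ^ suc i * s
  2^*2*≡2^suc* i s = trans (sym (*-assoc (2 ^ i) 2 s)) (cong (_* s) (*-comm (2 ^ i) 2))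

  InClass-children : ∀ {i r x} → InClass i r x → ∃ λ y → IsChild i r y × InClass (suc i) y x
  InClass-children {i} {r} (q , refl) with even-or-odd q
  ... | inj₁ (s , refl) = r , inj₁ refl , s , cong (_+ r) (2^*2*≡2^suc* i s)
  ... | inj₂ (s , refl) = 2 ^ i + r , inj₂ refl , s , (begin
    2 ^ i * suc (2 * s) + r          ≡⟨ cong (_+ r) (*-suc (2 ^ i) (2 * s)) ⟩
    2 ^ i + 2 ^ i * (2 * s) + r      ≡⟨ cong (λ t → 2 ^ i + t + r) (2^*2*≡2^suc* i s) ⟩
    2 ^ i + 2 ^ suc i * s + r        ≡⟨ cong (_+ r) (+-comm (2 ^ i) (2 ^ suc i * s)) ⟩
    2 ^ suc i * s + 2 ^ i + r        ≡⟨ +-assoc (2 ^ suc i * s) (2 ^ i) r ⟩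
    2 ^ suc i * s + (2 ^ i + r)      ∎)

  InClass-residue-unique : ∀ {i r r′ x} → InClass i r x → InClass i r′ x → r < 2 ^ i → r′ < 2 ^ i → r ≡ r′
  InClass-residue-unique {i} x∈r x∈r′ r< r′< = trans (sym (residue x∈r r<)) (residue x∈r′ r′<)
    where
    instance _ = m^n≢0 2 i
    residue : ∀ {r x} → InClass i r x → r < 2 ^ i → x % 2 ^ i ≡ r
    residue {r} (q , refl) r<2^i = begin
      (2 ^ i * q + r) % 2 ^ i  ≡⟨ cong (_% 2 ^ i) (trans (+-comm (2 ^ i * q) r) (cong (r +_) (*-comm (2 ^ i) q))) ⟩
      (r + q * 2 ^ i) % 2 ^ i  ≡⟨ [m+kn]%n≡m%n r q (2 ^ i) ⟩
      r % 2 ^ i                ≡⟨ m<n⇒m%n≡m r<2^i ⟩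
      r                        ∎

  ChildChain : (ℕ → ℕ) → Set
  ChildChain node = ∀ i → IsChild i (node i) (node (suc i))

  chain-InClass : ∀ {node} → ChildChain node → ∀ i k → InClass i (node i) (node (k + i))
  chain-InClass {node} chain i zero = InClass-refl i (node i)
  chain-InClass {node} chain i (suc k) with chain (k + i)
  ... | inj₁ eq = subst (InClass i (node i)) (sym eq) (chain-InClass chain i k)
  ... | inj₂ eq = subst (InClass i (node i)) (sym eq) (InClass-+2^ k (chain-InClass chain i k))

  chain-< : ∀ {node} → ChildChain node → node 0 ≡ 0 → ∀ i → node i < 2 ^ i
  chain-< chain node0≡0 zero = subst (_< 1) (sym node0≡0) (s≤s z≤n)
  chain-< {node} chain node0≡0 (suc i) with chain i | chain-< chain node0≡0 i
  ... | inj₁ eq | lt = subst (_< 2 ^ suc i) (sym eq) (<-≤-trans lt (m≤m+n (2 ^ i) _))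
  ... | inj₂ eq | lt = subst (_< 2 ^ suc i) (sym eq) (+-monoʳ-< (2 ^ i) (<-≤-trans lt (m≤m+n (2 ^ i) 0)))

  module UniqueChildren (Q : ℕ → ℕ → Set) (Q-root : Q 0 0)
    (Q-child : ∀ {i r} → Q i r → Q (suc i) r ⊎ Q (suc i) (2 ^ i + r)) where

    private
      child : ∀ {i} → Σ ℕ (Q i) → Σ ℕ (Q (suc i))
      child {i} (r , q) = [ (r ,_) , (2 ^ i + r ,_) ]′ (Q-child q)

      child-IsChild : ∀ {i} (p : Σ ℕ (Q i)) → IsChild i (proj₁ p) (proj₁ (child p))
      child-IsChild (r , q) with Q-child q
      ... | inj₁ _ = inj₁ refl
      ... | inj₂ _ = inj₂ refl

      approx : ∀ i → Σ ℕ (Q i)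
      approx zero = 0 , Q-root
      approx (suc i) = child (approx i)

    path : ℕ → ℕ
    path i = proj₁ (approx i)

    path-Q : ∀ i → Q i (path i)
    path-Q i = proj₂ (approx i)

    path-child : ChildChain path
    path-child i = child-IsChild (approx i)

    path-< : ∀ i → path i < 2 ^ i
    path-< = chain-< path-child refl

    module _ (Q-unique : ∀ {i r} → Q i r → Q (suc i) r → Q (suc i) (2 ^ i + r) → ⊥)
             (Q-residue : ∀ {i q x} → Q i (2 ^ i * q + x) → Q i x)
             (Q-pred : ∀ {i x} → Q (suc i) x → Q i x) where

      Q-children-unique : ∀ {i r y y′} → Q i r → IsChild i r y → IsChild i r y′ →
                          Q (suc i) y → Q (suc i) y′ → y ≡ y′
      Q-children-unique _ (inj₁ refl) (inj₁ refl) _ _ = refl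
      Q-children-unique _ (inj₂ refl) (inj₂ refl) _ _ = refl
      Q-children-unique q (inj₁ refl) (inj₂ refl) q₁ q₂ = ⊥-elim (Q-unique q q₁ q₂)
      Q-children-unique q (inj₂ refl) (inj₁ refl) q₁ q₂ = ⊥-elim (Q-unique q q₂ q₁)

      Q⇒InClass-path : ∀ i {x} → Q i x → InClass i (path i) x
      Q⇒InClass-path zero {x} _ = x , sym (trans (+-identityʳ (1 * x)) (*-identityˡ x))
      Q⇒InClass-path (suc i) qx with InClass-children {i} (Q⇒InClass-path i (Q-pred qx))
      ... | y , y-child , q , refl = q , cong (2 ^ suc i * q +_)
            (Q-children-unique (path-Q i) y-child (path-child i) (Q-residue qx) (path-Q (suc i)))

module TwoAdic where
  open import Data.Nat as ℕ using (ℕ; zero; suc; _≤_; _<_; z≤n; s≤s)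
  import Data.Nat.Properties as ℕ
  open import Data.Nat.Primality using (prime?; euclidsLemma)
  open import Data.Integer as ℤ using (ℤ; +_; _+_; _*_; _-_; _◃_)
  import Data.Integer.Properties as ℤ
  import Data.Nat.Divisibility as ℕ
  open import Data.Integer.DivMod using (_%_; _/_; a≡a%n+[a/n]*n; n%d<d)
  open import Data.Integer.Divisibility.Signed
  open import Data.Integer.Tactic.RingSolver using (solve-∀)
  open import Data.Empty using (⊥-elim)
  open import Data.Product using (∃; _×_; _,_)
  open import Data.Sum as Sum using (_⊎_; inj₁; inj₂)
  open import Function using (_∘_; id)
  open import Relation.Nullary using (¬_; yes; no)
  open import Relation.Nullary.Decidable using (from-yes)
  open import Relation.Binary.PropositionalEquality

  ∣m-n∣n⇒∣m : ∀ {i m n} → i ∣ m - n → i ∣ n → i ∣ m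
  ∣m-n∣n⇒∣m {i} {m} {n} d₁ d₂ = subst (i ∣_) (shape m n) (∣m∣n⇒∣m+n d₁ d₂)
    where
    shape : ∀ m n → m - n + n ≡ m
    shape = solve-∀

  ∣m-n∣m⇒∣n : ∀ {i m n} → i ∣ m - n → i ∣ m → i ∣ n
  ∣m-n∣m⇒∣n {i} {m} {n} d₁ d₂ = subst (i ∣_) (shape m n) (∣m∣n⇒∣m-n d₂ d₁)
    where
    shape : ∀ m n → m - (m - n) ≡ n
    shape = solve-∀

  2^_ : ℕ → ℤ
  2^ e = + (2 ℕ.^ e)

  2^-suc : ∀ e → 2^ suc e ≡ + 2 * 2^ e
  2^-suc e = ℤ.pos-* 2 (2 ℕ.^ e)

  2^-+ : ∀ e d → 2^ (e ℕ.+ d) ≡ 2^ e * 2^ d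
  2^-+ e d = trans (cong +_ (ℕ.^-distribˡ-+-* 2 e d)) (ℤ.pos-* (2 ℕ.^ e) (2 ℕ.^ d))

  2^-mono-∣ : ∀ {e d} → e ≤ d → 2^ e ∣ 2^ d
  2^-mono-∣ {e} le with ℕ.m≤n⇒∃[o]m+o≡n le
  ... | o , refl = divides (2^ o) (trans (2^-+ e o) (ℤ.*-comm (2^ e) (2^ o)))

  ∣-weaken : ∀ {e d x} → e ≤ d → 2^ d ∣ x → 2^ e ∣ x
  ∣-weaken le = ∣-trans (2^-mono-∣ le)

  2^0∣ : ∀ x → 2^ 0 ∣ x
  2^0∣ x = divides x (sym (ℤ.*-identityʳ x))

  2^∣2^* : ∀ {e d} z → e ≤ d → 2^ e ∣ 2^ d * z
  2^∣2^* z le = ∣-weaken le (∣m⇒∣m*n z ∣-refl)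

  +[2^j*q+x] : ∀ j q x → + (2 ℕ.^ j ℕ.* q ℕ.+ x) ≡ + x + 2^ j * + q
  +[2^j*q+x] j q x = trans (ℤ.pos-+ (2 ℕ.^ j ℕ.* q) x)
    (trans (cong (_+ + x) (ℤ.pos-* (2 ℕ.^ j) q)) (ℤ.+-comm (2^ j * + q) (+ x)))

  +[2^j+x] : ∀ j x → + (2 ℕ.^ j ℕ.+ x) ≡ + x + 2^ j * + 1
  +[2^j+x] j x = trans (ℤ.pos-+ (2 ℕ.^ j) x) (trans (ℤ.+-comm (2^ j) (+ x)) (cong (_+_ (+ x)) (sym (ℤ.*-identityʳ (2^ j)))))

  Odd : ℤ → Set
  Odd z = ¬ + 2 ∣ z

  2∣*⇒2∣⊎2∣ : ∀ x y → + 2 ∣ x * y → + 2 ∣ x ⊎ + 2 ∣ y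
  2∣*⇒2∣⊎2∣ x y d = Sum.map ∣ᵤ⇒∣ ∣ᵤ⇒∣
    (euclidsLemma ℤ.∣ x ∣ ℤ.∣ y ∣ (from-yes (prime? 2)) (subst (2 ℕ.∣_) (ℤ.abs-* x y) (∣⇒∣ᵤ d)))

  odd-* : ∀ {x y} → Odd x → Odd y → Odd (x * y)
  odd-* {x} {y} ox oy d = Sum.[ ox , oy ] (2∣*⇒2∣⊎2∣ x y d)

  odd-±1 : ∀ s → Odd (s ◃ 1)
  odd-±1 s d with ℕ.∣1⇒≡1 (subst (2 ℕ.∣_) (ℤ.abs-◃ s 1) (∣⇒∣ᵤ d))
  ... | ()

  odd+even : ∀ {x} z → Odd x → Odd (x + + 2 * z)
  odd+even z ox d = ox (∣m+n∣n⇒∣m d (∣m⇒∣m*n z ∣-refl))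

  odd⇒2∣+1 : ∀ {x} → Odd x → + 2 ∣ x + + 1
  odd⇒2∣+1 {x} ox with x % + 2 | n%d<d x (+ 2) | a≡a%n+[a/n]*n x (+ 2)
  ... | 0 | _ | eq = ⊥-elim (ox (divides (x / + 2) (trans eq (ℤ.+-identityˡ _))))
  ... | 1 | _ | eq = divides (x / + 2 + + 1) (trans (cong (_+ + 1) eq) (shape (x / + 2)))
    where
    shape : ∀ q → + 1 + q * + 2 + + 1 ≡ (q + + 1) * + 2
    shape = solve-∀
  ... | suc (suc _) | s≤s (s≤s ()) | _

  odd+odd⇒2∣ : ∀ {x y} → Odd x → Odd y → + 2 ∣ x + y
  odd+odd⇒2∣ {x} {y} ox oy =
    subst (+ 2 ∣_) (shape x y) (∣m∣n⇒∣m-n (∣m∣n⇒∣m+n (odd⇒2∣+1 ox) (odd⇒2∣+1 oy)) ∣-refl)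
    where
    shape : ∀ x y → x + + 1 + (y + + 1) - + 2 ≡ x + y
    shape = solve-∀

  2∣⇒2^suc∣ : ∀ e {t} → + 2 ∣ t → 2^ suc e ∣ t * 2^ e
  2∣⇒2^suc∣ e {t} d = subst (_∣ t * 2^ e) (sym (2^-suc e)) (*-monoˡ-∣ (2^ e) d)

  2^suc∣⇒2∣ : ∀ e {t} → 2^ suc e ∣ t * 2^ e → + 2 ∣ t
  2^suc∣⇒2∣ e {t} d = *-cancelʳ-∣ (2^ e) {{ℕ.m^n≢0 2 e}} (subst (_∣ t * 2^ e) (2^-suc e) d)

  ∣⇒∣*2 : ∀ e {x} → 2^ e ∣ x → 2^ suc e ∣ x * + 2
  ∣⇒∣*2 e {x} d = subst (_∣ x * + 2) (trans (ℤ.*-comm (2^ e) (+ 2)) (sym (2^-suc e))) (*-monoˡ-∣ (+ 2) d)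

  ¬2^suc∣2^*odd : ∀ e {o} → Odd o → ¬ 2^ suc e ∣ 2^ e * o
  ¬2^suc∣2^*odd e {o} oo d = oo (2^suc∣⇒2∣ e (subst (2^ suc e ∣_) (ℤ.*-comm (2^ e) o) d))

  ∣-step : ∀ e {y o} → 2^ e ∣ y → Odd o → 2^ suc e ∣ y ⊎ 2^ suc e ∣ y + 2^ e * o
  ∣-step e {o = o} (divides t refl) oo with + 2 ∣? t
  ... | yes d = inj₁ (2∣⇒2^suc∣ e d)
  ... | no ot = inj₂ (subst (2^ suc e ∣_) (shape t o (2^ e)) (2∣⇒2^suc∣ e (odd+odd⇒2∣ ot oo)))
    where
    shape : ∀ t o p → (t + o) * p ≡ t * p + p * o
    shape = solve-∀

  ¬∣-step-both : ∀ e {y o} → Odd o → 2^ suc e ∣ y → ¬ 2^ suc e ∣ y + 2^ e * o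
  ¬∣-step-both e oo d₁ d₂ = ¬2^suc∣2^*odd e oo (∣m+n∣m⇒∣n d₂ d₁)

  ∣-cancel-odd : ∀ {a} → Odd a → ∀ e {y} → 2^ e ∣ a * y → 2^ e ∣ y
  ∣-cancel-odd oa zero {y} _ = 2^0∣ y
  ∣-cancel-odd {a} oa (suc e) d with ∣-cancel-odd oa e (∣-weaken (ℕ.n≤1+n e) d)
  ... | divides z refl = 2∣⇒2^suc∣ e {z} (Sum.[ ⊥-elim ∘ oa , id ] (2∣*⇒2∣⊎2∣ a z 2∣az))
    where
    2∣az : + 2 ∣ a * z
    2∣az = 2^suc∣⇒2∣ e (subst (2^ suc e ∣_) (sym (ℤ.*-assoc a z (2^ e))) d)

  ∣-split-root : ∀ e y → 2^ suc (e ℕ.+ e) ∣ y * (y + 2^ e) → 2^ suc e ∣ y ⊎ 2^ suc e ∣ y + 2^ e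
  ∣-split-root zero y _ with + 2 ∣? y
  ... | yes d = inj₁ d
  ... | no oy = inj₂ (odd⇒2∣+1 oy)
  ∣-split-root (suc e) y d with + 2 ∣? y
  ... | no oy = ⊥-elim (odd-* oy oy+2^ (∣-weaken {1} {suc (suc e ℕ.+ suc e)} (s≤s z≤n) d))
    where
    oy+2^ : Odd (y + 2^ suc e)
    oy+2^ h = oy (∣m+n∣n⇒∣m h (2^-mono-∣ {1} {suc e} (s≤s z≤n)))
  ... | yes (divides z refl) = Sum.map (∣⇒∣*2 (suc e)) (subst (2^ suc (suc e) ∣_) sum ∘ ∣⇒∣*2 (suc e)) (∣-split-root e z d′)
    where
    sum : (z + 2^ e) * + 2 ≡ z * + 2 + 2^ suc e
    sum = trans (ℤ.*-distribʳ-+ (+ 2) z (2^ e)) (cong (_+_ (z * + 2)) (trans (ℤ.*-comm (2^ e) (+ 2)) (sym (2^-suc e))))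
    exponent : 2^ suc (suc e ℕ.+ suc e) ≡ + 4 * 2^ suc (e ℕ.+ e)
    exponent = begin
      2^ suc (suc e ℕ.+ suc e)     ≡⟨ cong (2^_ ∘ suc ∘ suc) (ℕ.+-suc e e) ⟩
      2^ suc (suc (suc (e ℕ.+ e))) ≡⟨ 2^-suc (suc (suc (e ℕ.+ e))) ⟩
      + 2 * 2^ suc (suc (e ℕ.+ e)) ≡⟨ cong (+ 2 *_) (2^-suc (suc (e ℕ.+ e))) ⟩
      + 2 * (+ 2 * 2^ suc (e ℕ.+ e)) ≡⟨ ℤ.*-assoc (+ 2) (+ 2) (2^ suc (e ℕ.+ e)) ⟨
      + 4 * 2^ suc (e ℕ.+ e)       ∎
      where open ≡-Reasoning
    product : z * + 2 * (z * + 2 + 2^ suc e) ≡ + 4 * (z * (z + 2^ e))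
    product = trans (cong (λ p → z * + 2 * (z * + 2 + p)) (2^-suc e)) (shape z (2^ e))
      where
      shape : ∀ z p → z * + 2 * (z * + 2 + + 2 * p) ≡ + 4 * (z * (z + p))
      shape = solve-∀
    d′ : 2^ suc (e ℕ.+ e) ∣ z * (z + 2^ e)
    d′ = *-cancelˡ-∣ (+ 4) (subst₂ _∣_ exponent product d)

  exact-valuation : ∀ J {y} → ¬ 2^ J ∣ y → ∃ λ k → k < J × 2^ k ∣ y × ¬ 2^ suc k ∣ y
  exact-valuation zero {y} ¬d = ⊥-elim (¬d (2^0∣ y))
  exact-valuation (suc J) {y} ¬d with 2^ J ∣? y
  ... | yes d = J , ℕ.n<1+n J , d , ¬d
  ... | no ¬d′ with exact-valuation J ¬d′
  ... | k , k<J , dk , ¬dk = k , ℕ.m<n⇒m<1+n k<J , dk , ¬dk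

module ValuationTree (f : ℕ → ℤ) where
  import Data.Nat as ℕ
  import Data.Nat.Properties as ℕ
  open import Data.Integer using (+_; _+_; _*_; _-_)
  import Data.Integer.Properties as ℤ
  open import Data.Integer.Divisibility.Signed
  open import Data.Empty using (⊥-elim)
  open import Data.Maybe using (just; nothing)
  open import Data.Product using (_,_; proj₁; proj₂)
  open import Data.Sum using (inj₁; inj₂)
  open import Function using (_∘_)
  open import Relation.Nullary using (¬_; yes; no)
  open import Relation.Binary.PropositionalEquality
  open ResidueClasses using (InClass; _,_)
  open TwoAdic

  separated⇒NonTerminating : ∀ {i r x y K} → InClass i r x → InClass i r y →
                             2^ K ∣ f x → ¬ 2^ K ∣ f y → NonTerminating f i r
  separated⇒NonTerminating {K = K} _ (qy , refl) _ ¬dy (nothing , h) =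
    ¬dy (subst (2^ K ∣_) (sym (h qy)) (divides (+ 0) (sym (ℤ.*-zeroˡ (2^ K)))))
  separated⇒NonTerminating {K = K} (qx , refl) (qy , refl) dx ¬dy (just k , h) with K ℕ.≤? k
  ... | yes K≤k = ¬dy (∣-weaken K≤k (∣ᵤ⇒∣ (proj₁ (h qy))))
  ... | no K≰k = proj₂ (h qx) (∣⇒∣ᵤ (∣-weaken (ℕ.≰⇒> K≰k) dx))

  odd-gap⇒NonTerminating : ∀ {i r x y e o} → InClass i r x → InClass i r y →
                           2^ e ∣ f x → f y ≡ f x + 2^ e * o → Odd o → NonTerminating f i r
  odd-gap⇒NonTerminating {e = e} x∈ y∈ dx gap oo with ∣-step e dx oo
  ... | inj₁ d = separated⇒NonTerminating {K = suc e} x∈ y∈ d (¬∣-step-both e oo d ∘ subst (2^ suc e ∣_) gap)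
  ... | inj₂ d = separated⇒NonTerminating {K = suc e} y∈ x∈ (subst (2^ suc e ∣_) (sym gap) d) (λ d′ → ¬∣-step-both e oo d′ d)

  module _ (f-congruent : ∀ i q r → 2^ i ∣ f (2 ℕ.^ i ℕ.* q ℕ.+ r) - f r) where

    NonTerminating⇒∣ : ∀ {i r} → NonTerminating f i r → 2^ i ∣ f r
    NonTerminating⇒∣ {i} {r} nt with 2^ i ∣? f r
    ... | yes d = d
    ... | no ¬d with exact-valuation i ¬d
    ... | k , k<i , dk , ¬dk = ⊥-elim (nt (just k , λ q →
            ∣⇒∣ᵤ (∣m-n∣n⇒∣m {m = f (2 ℕ.^ i ℕ.* q ℕ.+ r)} (∣-weaken (ℕ.<⇒≤ k<i) (f-congruent i q r)) dk) ,
            ¬dk ∘ ∣m-n∣m⇒∣n {m = f (2 ℕ.^ i ℕ.* q ℕ.+ r)} (∣-weaken k<i (f-congruent i q r)) ∘ ∣ᵤ⇒∣))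

-- In the notation of the statement, b = b′ * 2, ℓ = suc m and Δ = 1 + 8 k.
module Quadratic (a b′ c : ℤ) (m : ℕ) (k : ℤ) where
  open import Data.Nat as ℕ using (_≤_; _⊓_)
  import Data.Nat.Properties as ℕ
  open import Data.Integer using (+_; _+_; _*_; _-_; _◃_)
  import Data.Integer.Properties as ℤ
  open import Data.Integer.Divisibility.Signed
  open import Data.Integer.Tactic.RingSolver using (solve-∀)
  open import Data.Sign as Sign using (Sign; opposite)
  open import Data.Empty using (⊥)
  open import Data.Product using (∃; _×_; _,_)
  open import Data.Sum as Sum using (_⊎_; inj₁; inj₂)
  open import Function using (_∘_)
  open import Relation.Nullary using (¬_)
  open import Relation.Binary.PropositionalEquality
  open ≡-Reasoning
  open ResidueClasses
  open TwoAdic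

  f : ℕ → ℤ
  f = quad a (b′ * + 2) c

  F : ℤ → ℤ
  F X = a * (X * X) + b′ * + 2 * X + c

  W : ℤ
  W = 2^ m

  ℓ M : ℕ
  ℓ = suc m
  M = suc ℓ

  ε : Sign → ℤ
  ε s = s ◃ 1

  u : ℤ → ℤ
  u X = a * X + b′

  -- The 2-adic factors of a·f are u X ∓ W·√Δ; taking √Δ ≡ 1 (mod 4), L s agrees with one
  -- of them modulo 2^ M.
  L : Sign → ℤ → ℤ
  L s X = u X - ε s * W

  2^ℓ≡2W : 2^ ℓ ≡ + 2 * W
  2^ℓ≡2W = 2^-suc m

  2^M≡4W : 2^ M ≡ + 4 * W
  2^M≡4W = trans (2^-suc ℓ) (trans (cong (+ 2 *_) 2^ℓ≡2W) (sym (ℤ.*-assoc (+ 2) (+ 2) W)))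

  2^[M+ℓ]≡8WW : 2^ (M ℕ.+ ℓ) ≡ + 8 * (W * W)
  2^[M+ℓ]≡8WW = trans (2^-+ M ℓ) (trans (cong₂ _*_ 2^M≡4W 2^ℓ≡2W) (shape W))
    where
    shape : ∀ W → + 4 * W * (+ 2 * W) ≡ + 8 * (W * W)
    shape = solve-∀

  F-shift : ∀ X P q → F (X + P * q) ≡ F X + P * q * (+ 2 * u X + a * P * q)
  F-shift X P q = shape a b′ c X P q
    where
    shape : ∀ a b′ c X P q → a * ((X + P * q) * (X + P * q)) + b′ * + 2 * (X + P * q) + c
          ≡ a * (X * X) + b′ * + 2 * X + c + P * q * (+ 2 * (a * X + b′) + a * P * q)
    shape = solve-∀

  L-shift : ∀ s X P q → L s (X + P * q) ≡ L s X + P * (a * q)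
  L-shift s X P q = shape a b′ X P q (ε s * W)
    where
    shape : ∀ a b′ X P q E → a * (X + P * q) + b′ - E ≡ a * X + b′ - E + P * (a * q)
    shape = solve-∀

  u≡L+εW : ∀ s X → u X ≡ L s X + ε s * W
  u≡L+εW s X = shape (u X) (ε s * W)
    where
    shape : ∀ U E → U ≡ U - E + E
    shape = solve-∀

  L-opposite : ∀ s X → L (opposite s) X ≡ L s X + 2^ ℓ * ε s
  L-opposite s X = trans (shape s a b′ X W) (cong (λ P → L s X + P * ε s) (sym 2^ℓ≡2W))
    where
    shape : ∀ s a b′ X W → a * X + b′ - ε (opposite s) * W ≡ a * X + b′ - ε s * W + + 2 * W * ε s
    shape Sign.+ = solve-∀
    shape Sign.- = solve-∀

  f-congruent : ∀ i q r → 2^ i ∣ f (2 ℕ.^ i ℕ.* q ℕ.+ r) - f r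
  f-congruent i q r = divides (+ q * D) (begin
    F (+ (2 ℕ.^ i ℕ.* q ℕ.+ r)) - F (+ r)  ≡⟨ cong (λ X → F X - F (+ r)) (+[2^j*q+x] i q r) ⟩
    F (+ r + 2^ i * + q) - F (+ r)          ≡⟨ cong (_- F (+ r)) (F-shift (+ r) (2^ i) (+ q)) ⟩
    F (+ r) + 2^ i * + q * D - F (+ r)      ≡⟨ shape (F (+ r)) (2^ i) (+ q) D ⟩
    + q * D * 2^ i                          ∎)
    where
    D = + 2 * u (+ r) + a * 2^ i * + q
    shape : ∀ F P q D → F + P * q * D - F ≡ q * D * P
    shape = solve-∀

  L-InClass≡ : ∀ s {d x y} (y∈ : InClass d x y) → L s (+ y) ≡ L s (+ x) + 2^ d * (a * + InClass.quotient y∈)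
  L-InClass≡ s {d} {x} (q , refl) = trans (cong (L s) (+[2^j*q+x] d q x)) (L-shift s (+ x) (2^ d) (+ q))

  L-InClass : ∀ s {d j x y} → j ≤ d → InClass d x y → 2^ j ∣ L s (+ x) → 2^ j ∣ L s (+ y)
  L-InClass s {j = j} j≤d y∈ dx =
    subst (2^ j ∣_) (sym (L-InClass≡ s y∈)) (∣m∣n⇒∣m+n dx (2^∣2^* _ j≤d))

  L-InClass⁻ : ∀ s {d j x y} → j ≤ d → InClass d x y → 2^ j ∣ L s (+ y) → 2^ j ∣ L s (+ x)
  L-InClass⁻ s {j = j} j≤d y∈ dy = ∣m+n∣n⇒∣m (subst (2^ j ∣_) (L-InClass≡ s y∈) dy) (2^∣2^* _ j≤d)

  L-child : ∀ s i r → L s (+ (2 ℕ.^ i ℕ.+ r)) ≡ L s (+ r) + 2^ i * a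
  L-child s i r = trans (cong (L s) (+[2^j+x] i r))
    (trans (L-shift s (+ r) (2^ i) (+ 1)) (cong (λ z → L s (+ r) + 2^ i * z) (ℤ.*-identityʳ a)))

  module _ (a-odd : Odd a) (disc : b′ * b′ - a * c ≡ W * W * (+ 1 + + 8 * k)) where

    L-product : ∀ s X → L s X * L (opposite s) X ≡ a * F X + + 8 * k * (W * W)
    L-product s X = begin
      L s X * L (opposite s) X                    ≡⟨ complete-square s a b′ c X W ⟩
      a * F X + (b′ * b′ - a * c) - W * W         ≡⟨ cong (λ D → a * F X + D - W * W) disc ⟩
      a * F X + W * W * (+ 1 + + 8 * k) - W * W   ≡⟨ shape (a * F X) W k ⟩
      a * F X + + 8 * k * (W * W)                 ∎
      where
      complete-square : ∀ s a b′ c X W → (a * X + b′ - ε s * W) * (a * X + b′ - ε (opposite s) * W)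
                      ≡ a * (a * (X * X) + b′ * + 2 * X + c) + (b′ * b′ - a * c) - W * W
      complete-square Sign.+ = solve-∀
      complete-square Sign.- = solve-∀
      shape : ∀ A W k → A + W * W * (+ 1 + + 8 * k) - W * W ≡ A + + 8 * k * (W * W)
      shape = solve-∀

    L-root⇒F-∣ : ∀ s {X} → 2^ M ∣ L s X → 2^ (M ℕ.+ ℓ) ∣ F X
    L-root⇒F-∣ s {X} (divides l eq) = ∣-cancel-odd a-odd (M ℕ.+ ℓ) (divides (+ 2 * l * l + ε s * l - k) (begin
      a * F X                                                 ≡⟨ cancel (a * F X) E ⟨
      a * F X + E - E                                         ≡⟨ cong (_- E) (L-product s X) ⟨
      L s X * L (opposite s) X - E                            ≡⟨ cong (λ Y → L s X * Y - E) (L-opposite s X) ⟩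
      L s X * (L s X + 2^ ℓ * ε s) - E                        ≡⟨ cong₂ (λ Y P → Y * (Y + P * ε s) - E) L≡ 2^ℓ≡2W ⟩
      l * (+ 4 * W) * (l * (+ 4 * W) + + 2 * W * ε s) - E      ≡⟨ shape l W (ε s) k ⟩
      (+ 2 * l * l + ε s * l - k) * (+ 8 * (W * W))           ≡⟨ cong ((+ 2 * l * l + ε s * l - k) *_) 2^[M+ℓ]≡8WW ⟨
      (+ 2 * l * l + ε s * l - k) * 2^ (M ℕ.+ ℓ)              ∎))
      where
      E = + 8 * k * (W * W)
      cancel : ∀ A E → A + E - E ≡ A
      cancel = solve-∀
      L≡ : L s X ≡ l * (+ 4 * W)
      L≡ = trans eq (cong (l *_) 2^M≡4W)
      shape : ∀ l W e k → l * (+ 4 * W) * (l * (+ 4 * W) + + 2 * W * e) - + 8 * k * (W * W)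
                        ≡ (+ 2 * l * l + e * l - k) * (+ 8 * (W * W))
      shape = solve-∀

    F-shift-near-root : ∀ s {X} j q → M ≤ j → 2^ M ∣ L s X →
                        ∃ λ z → F (X + 2^ j * q) ≡ F X + 2^ (j ℕ.+ ℓ) * (q * (ε s + + 2 * z))
    F-shift-near-root s {X} j q M≤j (divides l eq) with ℕ.m≤n⇒∃[o]m+o≡n M≤j
    ... | t , refl = + 2 * l + a * 2^ t * q , (begin
      F (X + 2^ j * q)
        ≡⟨ F-shift X (2^ j) q ⟩
      F X + 2^ j * q * (+ 2 * u X + a * 2^ j * q)
        ≡⟨ cong (λ Y → F X + 2^ j * q * (+ 2 * Y + a * 2^ j * q)) (u≡L+εW s X) ⟩
      F X + 2^ j * q * (+ 2 * (L s X + ε s * W) + a * 2^ j * q)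
        ≡⟨ cong₂ (λ Y P → F X + 2^ j * q * (+ 2 * (Y + ε s * W) + a * P * q)) L≡ 2^j≡ ⟩
      F X + 2^ j * q * (+ 2 * (l * (+ 4 * W) + ε s * W) + a * (+ 4 * W * 2^ t) * q)
        ≡⟨ shape (F X) (2^ j) q l W (ε s) a (2^ t) ⟩
      F X + 2^ j * (+ 2 * W) * (q * (ε s + + 2 * (+ 2 * l + a * 2^ t * q)))
        ≡⟨ cong (λ P → F X + P * (q * (ε s + + 2 * (+ 2 * l + a * 2^ t * q)))) 2^[j+ℓ]≡ ⟨
      F X + 2^ (j ℕ.+ ℓ) * (q * (ε s + + 2 * (+ 2 * l + a * 2^ t * q))) ∎)
      where
      L≡ : L s X ≡ l * (+ 4 * W)
      L≡ = trans eq (cong (l *_) 2^M≡4W)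
      2^j≡ : 2^ j ≡ + 4 * W * 2^ t
      2^j≡ = trans (2^-+ M t) (cong (_* 2^ t) 2^M≡4W)
      2^[j+ℓ]≡ : 2^ (j ℕ.+ ℓ) ≡ 2^ j * (+ 2 * W)
      2^[j+ℓ]≡ = trans (2^-+ j ℓ) (cong (2^ j *_) 2^ℓ≡2W)
      shape : ∀ F P q l W e a T → F + P * q * (+ 2 * (l * (+ 4 * W) + e * W) + a * (+ 4 * W * T) * q)
                                ≡ F + P * (+ 2 * W) * (q * (e + + 2 * (+ 2 * l + a * T * q)))
      shape = solve-∀

    f-child-gap : ∀ s {i r} → M ≤ i → 2^ M ∣ L s (+ r) →
                  ∃ λ o → Odd o × f (2 ℕ.^ i ℕ.+ r) ≡ f r + 2^ (i ℕ.+ ℓ) * o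
    f-child-gap s {i} {r} M≤i d with F-shift-near-root s i (+ 1) M≤i d
    ... | z , eq = ε s + + 2 * z , odd+even z (odd-±1 s) ,
      trans (cong F (+[2^j+x] i r)) (trans eq (cong (λ o → f r + 2^ (i ℕ.+ ℓ) * o) (ℤ.*-identityˡ _)))

    f-near-root-mod : ∀ s {i q x} → M ≤ i → 2^ M ∣ L s (+ x) → 2^ (i ℕ.+ ℓ) ∣ f (2 ℕ.^ i ℕ.* q ℕ.+ x) - f x
    f-near-root-mod s {i} {q} {x} M≤i d with F-shift-near-root s i (+ q) M≤i d
    ... | z , eq = divides (+ q * (ε s + + 2 * z))
      (trans (cong (λ X → F X - f x) (+[2^j*q+x] i q x))
        (trans (cong (_- f x) eq) (shape (f x) (2^ (i ℕ.+ ℓ)) (+ q * (ε s + + 2 * z)))))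
      where
      shape : ∀ F P Z → F + P * Z - F ≡ Z * P
      shape = solve-∀

    -- x lies in the level-j node of the branch through the root on side s.
    record Near (s : Sign) (j x : ℕ) : Set where
      constructor _,_
      field
        L-∣ : 2^ (j ⊓ M) ∣ L s (+ x)
        f-∣ : M ≤ j → 2^ (j ℕ.+ ℓ) ∣ f x
    open Near

    near-low : ∀ {s j x} → j ≤ M → 2^ j ∣ L s (+ x) → Near s j x
    near-low {s} {j} {x} j≤M d = subst (λ e → 2^ e ∣ L s (+ x)) (sym (ℕ.m≤n⇒m⊓n≡m j≤M)) d , λ M≤j →
      let j≡M = ℕ.≤-antisym j≤M M≤j in
      subst (λ e → 2^ (e ℕ.+ ℓ) ∣ f x) (sym j≡M) (L-root⇒F-∣ s (subst (λ e → 2^ e ∣ L s (+ x)) j≡M d))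

    near-low⁻ : ∀ {s j x} → j ≤ M → Near s j x → 2^ j ∣ L s (+ x)
    near-low⁻ {s} {j} {x} j≤M n = subst (λ e → 2^ e ∣ L s (+ x)) (ℕ.m≤n⇒m⊓n≡m j≤M) (L-∣ n)

    near-high : ∀ {s j x} → M ≤ j → 2^ M ∣ L s (+ x) → 2^ (j ℕ.+ ℓ) ∣ f x → Near s j x
    near-high {s} {j} {x} M≤j dL df = subst (λ e → 2^ e ∣ L s (+ x)) (sym (ℕ.m≥n⇒m⊓n≡n M≤j)) dL , λ _ → df

    near-high⁻ : ∀ {s j x} → M ≤ j → Near s j x → 2^ M ∣ L s (+ x)
    near-high⁻ {s} {j} {x} M≤j n = subst (λ e → 2^ e ∣ L s (+ x)) (ℕ.m≥n⇒m⊓n≡n M≤j) (L-∣ n)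

    near-root : ∀ {s} → Near s 0 0
    near-root {s} = 2^0∣ (L s (+ 0)) , λ ()

    L-child-root : ∀ s {i r} → M ≤ i → 2^ M ∣ L s (+ r) → 2^ M ∣ L s (+ (2 ℕ.^ i ℕ.+ r))
    L-child-root s {i} {r} M≤i d = subst (2^ M ∣_) (sym (L-child s i r)) (∣m∣n⇒∣m+n d (2^∣2^* a M≤i))

    near-child : ∀ {s i r} → Near s i r → Near s (suc i) r ⊎ Near s (suc i) (2 ℕ.^ i ℕ.+ r)
    near-child {s} {i} {r} n with ℕ.≤-<-connex (suc i) M
    ... | inj₁ i<M = Sum.map (near-low i<M) (near-low i<M ∘ subst (2^ suc i ∣_) (sym (L-child s i r)))
                             (∣-step i (near-low⁻ (ℕ.<⇒≤ i<M) n) a-odd)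
    ... | inj₂ M<1+i with ℕ.m<1+n⇒m≤n M<1+i
    ... | M≤i with f-child-gap s M≤i (near-high⁻ M≤i n)
    ... | o , odd-o , gap =
      Sum.map (near-high M≤1+i (near-high⁻ M≤i n))
              (near-high M≤1+i (L-child-root s M≤i (near-high⁻ M≤i n)) ∘ subst (2^ suc (i ℕ.+ ℓ) ∣_) (sym gap))
              (∣-step (i ℕ.+ ℓ) (f-∣ n M≤i) odd-o)
      where M≤1+i = ℕ.m≤n⇒m≤1+n M≤i

    near-unique : ∀ {s i r} → Near s i r → Near s (suc i) r → Near s (suc i) (2 ℕ.^ i ℕ.+ r) → ⊥
    near-unique {s} {i} {r} n n₁ n₂ with ℕ.≤-<-connex (suc i) M
    ... | inj₁ i<M = ¬∣-step-both i a-odd (near-low⁻ i<M n₁) (subst (2^ suc i ∣_) (L-child s i r) (near-low⁻ i<M n₂))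
    ... | inj₂ M<1+i with ℕ.m<1+n⇒m≤n M<1+i
    ... | M≤i with f-child-gap s M≤i (near-high⁻ M≤i n)
    ... | o , odd-o , gap = ¬∣-step-both (i ℕ.+ ℓ) odd-o (f-∣ n₁ M≤1+i) (subst (2^ suc (i ℕ.+ ℓ) ∣_) gap (f-∣ n₂ M≤1+i))
      where M≤1+i = ℕ.m≤n⇒m≤1+n M≤i

    near-residue : ∀ {s i q x} → Near s i (2 ℕ.^ i ℕ.* q ℕ.+ x) → Near s i x
    near-residue {s} {i} {q} {x} n = dL , λ M≤i →
      ∣m-n∣m⇒∣n (f-near-root-mod s M≤i (subst (λ e → 2^ e ∣ L s (+ x)) (ℕ.m≥n⇒m⊓n≡n M≤i) dL)) (f-∣ n M≤i)
      where
      dL : 2^ (i ⊓ M) ∣ L s (+ x)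
      dL = L-InClass⁻ s (ℕ.m⊓n≤m i M) (q , refl) (L-∣ n)

    near-pred : ∀ {s i x} → Near s (suc i) x → Near s i x
    near-pred {i = i} n = ∣-weaken (ℕ.⊓-monoˡ-≤ M (ℕ.n≤1+n i)) (L-∣ n) ,
                          λ M≤i → ∣-weaken (ℕ.n≤1+n (i ℕ.+ ℓ)) (f-∣ n (ℕ.m≤n⇒m≤1+n M≤i))

    module Branch (s : Sign) = UniqueChildren (Near s) near-root near-child
    open Branch using (path; path-Q; path-child; path-<)

    near⇒InClass-path : ∀ s i {x} → Near s i x → InClass i (path s i) x
    near⇒InClass-path s = Branch.Q⇒InClass-path s near-unique near-residue near-pred

    branch-nonterminating : ∀ s i → NonTerminating f i (path s i)
    branch-nonterminating s i = from-gap (f-child-gap s M≤j (near-high⁻ M≤j (path-Q s j)))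
      where
      j = M ℕ.+ i
      M≤j : M ≤ j
      M≤j = ℕ.m≤m+n M i
      x∈ : InClass i (path s i) (path s j)
      x∈ = chain-InClass (path-child s) i M
      from-gap : (∃ λ o → Odd o × f (2 ℕ.^ j ℕ.+ path s j) ≡ f (path s j) + 2^ (j ℕ.+ ℓ) * o) →
                 NonTerminating f i (path s i)
      from-gap (o , odd-o , gap) =
        ValuationTree.odd-gap⇒NonTerminating f {e = j ℕ.+ ℓ} x∈ (InClass-+2^ M x∈) (f-∣ (path-Q s j) M≤j) gap odd-o

    branch : Sign → InfiniteBranch f
    branch s = record
      { node = path s ; node-lt = path-< s ; node-child = path-child s ; node-nonterm = branch-nonterminating s }

    branches-distinct : ¬ SameBranch (branch Sign.+) (branch Sign.-)
    branches-distinct same = ¬∣-step-both ℓ (odd-±1 Sign.+) d₊ (subst (2^ M ∣_) (L-opposite Sign.+ (+ r)) d₋)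
      where
      r = path Sign.- M
      d₊ : 2^ M ∣ L Sign.+ (+ r)
      d₊ = subst (λ x → 2^ M ∣ L Sign.+ (+ x)) (same M) (near-high⁻ ℕ.≤-refl (path-Q Sign.+ M))
      d₋ : 2^ M ∣ L Sign.- (+ r)
      d₋ = near-high⁻ ℕ.≤-refl (path-Q Sign.- M)

    near-some-root : ∀ {x} → 2^ (M ℕ.+ ℓ) ∣ f x → ∃ λ s → 2^ M ∣ L s (+ x)
    near-some-root {x} d = Sum.[ (Sign.+ ,_) , (λ h → Sign.- , subst (2^ M ∣_) (sym L₋≡) h) ]′
                                 (∣-split-root ℓ y (subst (2^ (M ℕ.+ ℓ) ∣_) product d′))
      where
      y = L Sign.+ (+ x)
      L₋≡ : L Sign.- (+ x) ≡ y + 2^ ℓ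
      L₋≡ = trans (L-opposite Sign.+ (+ x)) (cong (_+_ y) (ℤ.*-identityʳ (2^ ℓ)))
      product : a * F (+ x) + + 8 * k * (W * W) ≡ y * (y + 2^ ℓ)
      product = trans (sym (L-product Sign.+ (+ x))) (cong (y *_) L₋≡)
      8kWW≡ : + 8 * k * (W * W) ≡ k * 2^ (M ℕ.+ ℓ)
      8kWW≡ = trans (shape k W) (cong (k *_) (sym 2^[M+ℓ]≡8WW))
        where
        shape : ∀ k W → + 8 * k * (W * W) ≡ k * (+ 8 * (W * W))
        shape = solve-∀
      d′ : 2^ (M ℕ.+ ℓ) ∣ a * F (+ x) + + 8 * k * (W * W)
      d′ = ∣m∣n⇒∣m+n (∣n⇒∣m*n a d) (divides k 8kWW≡)

    module _ (C : InfiniteBranch f) where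

      node-∣ : ∀ i → 2^ i ∣ f (node C i)
      node-∣ i = ValuationTree.NonTerminating⇒∣ f f-congruent {i} (node-nonterm C i)

      same-branch : ∀ s → 2^ M ∣ L s (+ node C (M ℕ.+ ℓ)) → SameBranch C (branch s)
      same-branch s d i = InClass-residue-unique C∈ (near⇒InClass-path s i near) (node-lt C i) (path-< s i)
        where
        y = node C (i ℕ.+ (M ℕ.+ ℓ))
        C∈ : InClass i (node C i) y
        C∈ = subst (InClass i (node C i) ∘ node C) (ℕ.+-comm (M ℕ.+ ℓ) i) (chain-InClass (node-child C) i (M ℕ.+ ℓ))
        near : Near s i y
        near = ∣-weaken (ℕ.m⊓n≤n i M) (L-InClass s (ℕ.m≤m+n M ℓ) (chain-InClass (node-child C) (M ℕ.+ ℓ) i) d) ,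
               λ _ → ∣-weaken (ℕ.+-monoʳ-≤ i (ℕ.m≤n+m ℓ M)) (node-∣ (i ℕ.+ (M ℕ.+ ℓ)))

      branch-classification : SameBranch C (branch Sign.+) ⊎ SameBranch C (branch Sign.-)
      branch-classification = classify (near-some-root (node-∣ (M ℕ.+ ℓ)))
        where
        classify : (∃ λ s → 2^ M ∣ L s (+ node C (M ℕ.+ ℓ))) →
                   SameBranch C (branch Sign.+) ⊎ SameBranch C (branch Sign.-)
        classify (Sign.+ , d) = inj₁ (same-branch Sign.+ d)
        classify (Sign.- , d) = inj₂ (same-branch Sign.- d)

    has-exactly-two-branches : HasExactlyTwoInfiniteBranches f
    has-exactly-two-branches = branch Sign.+ , branch Sign.- , branches-distinct , branch-classification

open import Data.Nat as ℕ using (_≥_; _^_; z≤n; s≤s)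
import Data.Nat.Properties as ℕ
open import Data.Integer using (+_; _+_; _*_; _-_)
import Data.Integer.Properties as ℤ
open import Data.Integer.Divisibility using (_∣_)
open import Data.Integer.Divisibility.Signed using (divides; ∣ᵤ⇒∣; ∣⇒∣ᵤ)
open import Data.Integer.DivMod using (_%_; _/_; a≡a%n+[a/n]*n)
open import Data.Integer.Tactic.RingSolver using (solve-∀)
open import Function using (_∘_)
open import Relation.Binary.PropositionalEquality
open import Relation.Nullary using (¬_)
open TwoAdic using (2^_)

%8≡1⇒≡1+8* : ∀ Δ → Δ % + 8 ≡ 1 → Δ ≡ + 1 + + 8 * (Δ / + 8)
%8≡1⇒≡1+8* Δ Δ%8≡1 = trans (a≡a%n+[a/n]*n Δ (+ 8))
  (cong₂ _+_ (cong +_ Δ%8≡1) (ℤ.*-comm (Δ / + 8) (+ 8)))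

halved-discriminant : ∀ a b′ c m Δ → (b′ * + 2) * (b′ * + 2) - + 4 * a * c ≡ + (4 ^ suc m) * Δ →
                      b′ * b′ - a * c ≡ 2^ m * 2^ m * Δ
halved-discriminant a b′ c m Δ disc = ℤ.*-cancelˡ-≡ (+ 4) (b′ * b′ - a * c) (2^ m * 2^ m * Δ) (begin
  + 4 * (b′ * b′ - a * c)                  ≡⟨ shape₁ a b′ c ⟩
  (b′ * + 2) * (b′ * + 2) - + 4 * a * c    ≡⟨ disc ⟩
  + (4 ^ suc m) * Δ                        ≡⟨ cong (_* Δ) 4^[1+m]≡ ⟩
  + 4 * (2^ m * 2^ m) * Δ                  ≡⟨ ℤ.*-assoc (+ 4) (2^ m * 2^ m) Δ ⟩
  + 4 * (2^ m * 2^ m * Δ)                  ∎)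
  where
  open ≡-Reasoning
  shape₁ : ∀ a b′ c → + 4 * (b′ * b′ - a * c) ≡ (b′ * + 2) * (b′ * + 2) - + 4 * a * c
  shape₁ = solve-∀
  4^m≡2^m*2^m : 4 ^ m ≡ 2 ^ m ℕ.* 2 ^ m
  4^m≡2^m*2^m = trans (ℕ.^-*-assoc 2 2 m)
    (trans (cong (λ n → 2 ^ (m ℕ.+ n)) (ℕ.+-identityʳ m)) (ℕ.^-distribˡ-+-* 2 m m))
  4^[1+m]≡ : + (4 ^ suc m) ≡ + 4 * (2^ m * 2^ m)
  4^[1+m]≡ = trans (ℤ.pos-* 4 (4 ^ m))
    (cong (+ 4 *_) (trans (cong +_ 4^m≡2^m*2^m) (ℤ.pos-* (2 ^ m) (2 ^ m))))

proposition9 : (a b c : ℤ) → ¬ (+ 2 ∣ a) → (+ 2 ∣ b) →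
    (ℓ : ℕ) → (Δ : ℤ) → ℓ ≥ 1 →
    b * b - + 4 * a * c ≡ + (4 ^ ℓ) * Δ →
    ¬ (+ (4 ^ suc ℓ) ∣ (b * b - + 4 * a * c)) →
    Δ % + 8 ≡ 1 →
    HasExactlyTwoInfiniteBranches (quad a b c)
proposition9 a b c ¬2∣a 2∣b (suc m) Δ (s≤s z≤n) disc _ Δ%8≡1 with ∣ᵤ⇒∣ {+ 2} {b} 2∣b
... | divides b′ refl = Quadratic.has-exactly-two-branches a b′ c m (Δ / + 8) (¬2∣a ∘ ∣⇒∣ᵤ)
  (trans (halved-discriminant a b′ c m Δ disc) (cong (2^ m * 2^ m *_) (%8≡1⇒≡1+8* Δ Δ%8≡1)))
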